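{- Suppose that whenever $I_i$ and $I_j$ are high intervals with $i<j$ we have $\rho_i>\rho_j$. If the interval $I_i$ ($i\ge1$) is nice, then $|\Theta_{i+1}|\le\frac12|\Theta_i|$.
   Context: Single-item Byzantine secretary setting: $n$ items with real values $\mathrm{val}(e)$ and arrival times $\mathrm{time}(e)$; items are green or red; the adversary fixes values and arrival times in $[0,1]$ of red items; green items arrive at independent uniform times in $[0,1]$. $g_{\max}$ is the most valuable green item, $g_2$ the second most valuable, $C^*:=\mathrm{val}(g_2)$. Let $I_0:=[0,\frac14]$ and partition $(\frac14,\frac34]$ into $K$ consecutive intervals $I_1,\ldots,I_K$ of width $\frac1{2K}$. $\rho_i$ is the maximum value of a red item in $I_i$ ($-\infty$ if none), $\widehat\mu_i$ the maximum value of any item in $I_i$. $I_i$ is high if $\rho_i\ge C^*$, low otherwise. $I_i$ ($i\ge1$) is nice if $I_i$ and $I_{i-1}$ are both high and $g_{\max}$ does not arrive in $I_{i-1}$. Procedure Search: for $i=1,\ldots,K$: $\widehat L_i:=$ the maximum value of an item already picked by Search ($-\infty$ if none); $\widehat U_i:=\widehat\mu_{i-1}$; $\widehat\Theta_i:=\{\mathrm{val}(e):\mathrm{time}(e)\in[0,\frac14],\ \widehat L_i<\mathrm{val}(e)\le\widehat U_i\}$; pick the first item (if any) in $I_i$ with value at least $\mathrm{median}(\widehat\Theta_i)$, where $\mathrm{median}(\emptyset)=-\infty$. ($\widehat L_{K+1}$ is defined the same way after interval $I_K$.) Define $U_i:=\min\{\rho_j: j<i,\ I_j\text{ high}\}$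 and $\Theta_i:=\{\mathrm{val}(e):\mathrm{time}(e)\in[0,\frac14],\ \widehat L_i<\mathrm{val}(e)\le U_i\}$.
   Formalization: The item values $\mathrm{val}(e)$ and arrival times $\mathrm{time}(e)$ are rational instead of real, and Search breaks ties in arrival time by taking the item of smaller index. -}

module Defs where

open import Data.Bool using (Bool; true; false; _∧_; _∨_; not; if_then_else_; T)
open import Data.Nat as ℕ using (ℕ; zero; suc; ⌊_/2⌋; _∸_; NonZero)
open import Data.Nat.Properties using (m*n≢0)
open import Data.Integer using (+_)
open import Data.Fin using (Fin)
open import Data.List using (List; []; _∷_; map; length; foldr; filterᵇ; allFin; deduplicateᵇ)
open import Data.Maybe using (Maybe; just; nothing)
open import Data.Rational using (ℚ; _/_; _≤ᵇ_; _≟_)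
open import Relation.Nullary using (does)

data Ext : Set where
  -∞ : Ext
  fin : ℚ → Ext
  +∞ : Ext

infix 4 _≤ᵉ_ _<ᵉ_

_≤ᵉ_ : Ext → Ext → Bool
-∞    ≤ᵉ _     = true
fin _ ≤ᵉ -∞    = false
fin p ≤ᵉ fin q = p ≤ᵇ q
fin _ ≤ᵉ +∞    = true
+∞    ≤ᵉ +∞    = true
+∞    ≤ᵉ _     = false

_<ᵉ_ : Ext → Ext → Bool
x <ᵉ y = not (y ≤ᵉ x)

maxᵉ : Ext → Ext → Ext
maxᵉ x y = if x ≤ᵉ y then y else x

minᵉ : Ext → Ext → Ext
minᵉ x y = if x ≤ᵉ y then x else y

maxList : List Ext → Ext
maxList = foldr maxᵉ -∞

minList : List Ext → Ext
minList = foldr minᵉ +∞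

-- Finite sets of rationals, represented as duplicate-free sorted lists

insert : ℚ → List ℚ → List ℚ
insert x [] = x ∷ []
insert x (y ∷ ys) = if x ≤ᵇ y then x ∷ y ∷ ys else y ∷ insert x ys

sort : List ℚ → List ℚ
sort = foldr insert []

toSet : List ℚ → List ℚ
toSet xs = sort (deduplicateᵇ (λ p q → does (p ≟ q)) xs)

-- lower median of a sorted list: the ⌈m/2⌉-th smallest element
-- (1-indexed) of a list of length m; median ∅ = -∞
nth : ℕ → List ℚ → Ext
nth _ [] = -∞
nth zero (x ∷ _) = fin x
nth (suc k) (_ ∷ xs) = nth k xs

median : List ℚ → Ext
median xs = nth ⌊ length xs ∸ 1 /2⌋ xs

-- An instance of the Byzantine secretary setting: n items with values,
-- arrival times and colours (green = true, red = false)

record Instance (n : ℕ) : Set where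
  field
    val   : Fin n → ℚ
    time  : Fin n → ℚ
    green : Fin n → Bool

open Instance public

module _ (K : ℕ) .{{_ : NonZero K}} where

  -- boundary b j = 1/4 + j/(2K) = (K + 2j)/(4K); b 0 = 1/4, b K = 3/4
  bnd : ℕ → ℚ
  bnd j = _/_ (+ (K ℕ.+ 2 ℕ.* j)) (4 ℕ.* K) {{m*n≢0 4 K}}

  inI : ℕ → ℚ → Bool
  inI zero t = (+ 0 / 1 ≤ᵇ t) ∧ (t ≤ᵇ bnd 0)
  inI (suc j) t = not (t ≤ᵇ bnd j) ∧ (t ≤ᵇ bnd (suc j))

  module _ {n : ℕ} (I : Instance n) where

    items : List (Fin n)
    items = allFin n

    itemsIn : ℕ → List (Fin n)
    itemsIn i = filterᵇ (λ e → inI i (time I e)) items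

    ρ : ℕ → Ext
    ρ i = maxList (map (λ e → fin (val I e))
                       (filterᵇ (λ e → not (green I e)) (itemsIn i)))

    μ̂ : ℕ → Ext
    μ̂ i = maxList (map (λ e → fin (val I e)) (itemsIn i))

    Θset : Ext → Ext → List ℚ
    Θset lo hi = toSet (map (val I)
      (filterᵇ (λ e → (lo <ᵉ fin (val I e)) ∧ (fin (val I e) ≤ᵉ hi)) (itemsIn 0)))

    -- earliest item of a list (ties in time broken by smaller index)
    earliest : List (Fin n) → Maybe (Fin n)
    earliest [] = nothing
    earliest (e ∷ es) with earliest es
    ... | nothing = just e
    ... | just f = if time I e ≤ᵇ time I f then just e else just f

    -- value of the item picked by Search in I_i, given threshold m
    -- (-∞ if nothing is picked)
    pickedVal : ℕ → Ext → Ext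
    pickedVal i m with earliest (filterᵇ (λ e → m ≤ᵉ fin (val I e)) (itemsIn i))
    ... | nothing = -∞
    ... | just e = fin (val I e)

    -- Procedure Search.  L̂ i = max value picked in I_1 … I_(i-1)
    -- (L̂ 0 and L̂ 1 are -∞); Θ̂ i is the set used in round i.
    mutual
      L̂ : ℕ → Ext
      L̂ zero = -∞
      L̂ (suc zero) = -∞
      L̂ (suc (suc j)) = maxᵉ (L̂ (suc j)) (pickedVal (suc j) (median (Θ̂ (suc j))))

      Θ̂ : ℕ → List ℚ
      Θ̂ i = Θset (L̂ i) (μ̂ (i ∸ 1))

    module _ (Cstar : ℚ) where

      high : ℕ → Bool
      high i = fin Cstar ≤ᵉ ρ i

      highBelow : ℕ → List ℕ
      highBelow zero = []
      highBelow (suc i) = if high i then i ∷ highBelow i else highBelow i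

      U : ℕ → Ext
      U i = minList (map ρ (highBelow i))

      Θ : ℕ → List ℚ
      Θ i = Θset (L̂ i) (U i)

      -- I_i (i ≥ 1) is nice for the most valuable green item gmax
      nice : Fin n → ℕ → Bool
      nice gmax zero = false
      nice gmax (suc j) = high (suc j) ∧ high j ∧ not (inI j (time I gmax))

-- I_{i-1} is high and misses g_max, so every green item there is worth at most C* ≤ ρ_{i-1};
-- hence μ̂_{i-1} = ρ_{i-1}.  Since ρ decreases along high intervals, U_i = ρ_{i-1} and
-- U_{i+1} = ρ_i < ρ_{i-1}.  So Search runs round i on Θ̂_i = Θ_i, and Θ_{i+1} ⊆ Θ_i because
-- L̂ only grows.  If Search picks an item in I_i, then L̂_{i+1} is at least the median of Θ_i
-- and Θ_{i+1} lies strictly above it.  Otherwise the red item of value ρ_i in I_i is below the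
-- median, and so is all of Θ_{i+1}, whose values are at most U_{i+1} = ρ_i.  A duplicate-free
-- subset of one side of the lower median of a finite set has at most half its size.

{-# OPTIONS --safe #-}
module Submission where

open import Defs
open import Data.Bool using (Bool; true; false; T; not; _∧_)
open import Data.Bool.Properties using (T-∧; T-not-≡)
open import Data.Empty using (⊥-elim)
open import Data.Fin using (Fin)
open import Data.Integer using (+_)
open import Data.List
  using (List; []; _∷_; _++_; length; map; filter; filterᵇ; deduplicate; deduplicateᵇ)
open import Data.List.Membership.Propositional using (_∈_; _∉_)
open import Data.List.Membership.Propositional.Properties
  using (∈-∃++; ∈-++⁻; ∈-++⁺ʳ; ∈-filter⁻; ∈-filter⁺; ∈-map⁻; ∈-map⁺; ∈-deduplicate⁻; ∈-deduplicate⁺)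
open import Data.List.Properties using (filter-≐; length-++)
open import Data.List.Relation.Binary.Permutation.Propositional
  using (_↭_; prep; swap; ↭-refl; ↭-trans; ↭-sym)
open import Data.List.Relation.Binary.Permutation.Propositional.Properties
  using (↭-length; shift; ∈-resp-↭; All-resp-↭)
open import Data.List.Relation.Binary.Subset.Propositional using (_⊆_)
import Data.List.Relation.Binary.Subset.Propositional.Properties as Subset
open import Data.List.Relation.Unary.All as All using (All; []; _∷_)
open import Data.List.Relation.Unary.AllPairs as AllPairs using (AllPairs; []; _∷_)
open import Data.List.Relation.Unary.Any using (here; there)
open import Data.List.Relation.Unary.Unique.Propositional using (Unique)
open import Data.List.Relation.Unary.Unique.DecPropositional.Properties using (deduplicate-!)
open import Data.Maybe using (just; nothing)
open import Data.Nat as ℕ using (ℕ; zero; suc; _+_; _*_; ⌊_/2⌋; ⌈_/2⌉; z≤n; s≤s; NonZero)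
  renaming (_≤_ to _≤ℕ_; _<_ to _<ℕ_)
import Data.Nat.Properties as ℕ
open import Data.Product as Prod using (_×_; _,_; proj₁; proj₂; ∃; ∃₂; ∃-syntax)
open import Data.Rational using (ℚ; _≤_; _<_; _/_; _≤ᵇ_; _≟_)
import Data.Rational.Properties as ℚ
open import Data.Sum as Sum using (_⊎_; inj₁; inj₂; [_,_]′)
open import Data.Unit using (tt)
open import Function using (_∘_; Equivalence)
open import Relation.Nullary using (¬_; does; yes; no; contradiction)
open import Relation.Nullary.Decidable using (T?)
open import Relation.Binary.PropositionalEquality using (_≡_; _≢_; refl; sym; cong; subst; subst₂)
import Relation.Binary.PropositionalEquality as ≡

infix 4 _≤ₑ_ _<ₑ_

-- Records rather than plain T (x ≤ᵉ y), so that x and y can be inferred by unification.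
record _≤ₑ_ (x y : Ext) : Set where
  constructor *≤ₑ*
  field drop-*≤ₑ* : T (x ≤ᵉ y)

record _<ₑ_ (x y : Ext) : Set where
  constructor *<ₑ*
  field drop-*<ₑ* : T (x <ᵉ y)

open _≤ₑ_
open _<ₑ_

fin-≤ₑ⇒≤ : ∀ {p q} → fin p ≤ₑ fin q → p ≤ q
fin-≤ₑ⇒≤ {p} {q} (*≤ₑ* p≤q) = ℚ.≤ᵇ⇒≤ {p} {q} p≤q

≤⇒fin-≤ₑ : ∀ {p q} → p ≤ q → fin p ≤ₑ fin q
≤⇒fin-≤ₑ {p} {q} p≤q = *≤ₑ* (ℚ.≤⇒≤ᵇ {p} {q} p≤q)

≤ₑ-refl : ∀ x → x ≤ₑ x
≤ₑ-refl -∞      = *≤ₑ* tt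
≤ₑ-refl (fin p) = ≤⇒fin-≤ₑ ℚ.≤-refl
≤ₑ-refl +∞      = *≤ₑ* tt

≤ₑ-top : ∀ x → x ≤ₑ +∞
≤ₑ-top -∞      = *≤ₑ* tt
≤ₑ-top (fin _) = *≤ₑ* tt
≤ₑ-top +∞      = *≤ₑ* tt

≤ₑ-trans : ∀ {x y z} → x ≤ₑ y → y ≤ₑ z → x ≤ₑ z
≤ₑ-trans { -∞}                   _   _   = *≤ₑ* tt
≤ₑ-trans {fin _} {fin _} {fin _} p≤q q≤r = ≤⇒fin-≤ₑ (ℚ.≤-trans (fin-≤ₑ⇒≤ p≤q) (fin-≤ₑ⇒≤ q≤r))
≤ₑ-trans {fin _} {_}     {+∞}    _   _   = *≤ₑ* tt
≤ₑ-trans {+∞}    {+∞}    {+∞}    _   _   = *≤ₑ* tt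
≤ₑ-trans {fin _} { -∞}           (*≤ₑ* ())
≤ₑ-trans {fin _} {fin _} { -∞}   _   (*≤ₑ* ())
≤ₑ-trans {fin _} {+∞}    { -∞}   _   (*≤ₑ* ())
≤ₑ-trans {fin _} {+∞}    {fin _} _   (*≤ₑ* ())
≤ₑ-trans {+∞}    { -∞}           (*≤ₑ* ())
≤ₑ-trans {+∞}    {fin _}         (*≤ₑ* ())
≤ₑ-trans {+∞}    {+∞}    { -∞}   _   (*≤ₑ* ())
≤ₑ-trans {+∞}    {+∞}    {fin _} _   (*≤ₑ* ())

≤ₑ-total : ∀ x y → x ≤ₑ y ⊎ y ≤ₑ x
≤ₑ-total -∞      _       = inj₁ (*≤ₑ* tt)
≤ₑ-total (fin _) -∞      = inj₂ (*≤ₑ* tt)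
≤ₑ-total (fin p) (fin q) = [ inj₁ ∘ ≤⇒fin-≤ₑ , inj₂ ∘ ≤⇒fin-≤ₑ ]′ (ℚ.≤-total p q)
≤ₑ-total (fin _) +∞      = inj₁ (*≤ₑ* tt)
≤ₑ-total +∞      -∞      = inj₂ (*≤ₑ* tt)
≤ₑ-total +∞      (fin _) = inj₂ (*≤ₑ* tt)
≤ₑ-total +∞      +∞      = inj₁ (*≤ₑ* tt)

≤ₑ-antisym : ∀ {x y} → x ≤ₑ y → y ≤ₑ x → x ≡ y
≤ₑ-antisym { -∞}   { -∞}   _   _   = refl
≤ₑ-antisym {fin _} {fin _} p≤q q≤p = cong fin (ℚ.≤-antisym (fin-≤ₑ⇒≤ p≤q) (fin-≤ₑ⇒≤ q≤p))
≤ₑ-antisym {+∞}    {+∞}    _   _   = refl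
≤ₑ-antisym { -∞}   {fin _} _   (*≤ₑ* ())
≤ₑ-antisym { -∞}   {+∞}    _   (*≤ₑ* ())
≤ₑ-antisym {fin _} { -∞}   (*≤ₑ* ())
≤ₑ-antisym {fin _} {+∞}    _   (*≤ₑ* ())
≤ₑ-antisym {+∞}    { -∞}   (*≤ₑ* ())
≤ₑ-antisym {+∞}    {fin _} (*≤ₑ* ())

<ₑ⇒≱ₑ : ∀ {x y} → x <ₑ y → ¬ y ≤ₑ x
<ₑ⇒≱ₑ {x} {y} (*<ₑ* x<y) (*≤ₑ* y≤x) with y ≤ᵉ x
... | true = x<y

≱ₑ⇒<ₑ : ∀ {x y} → ¬ y ≤ₑ x → x <ₑ y
≱ₑ⇒<ₑ {x} {y} y≰x with y ≤ᵉ x in eq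
... | true  = contradiction (*≤ₑ* (subst T (sym eq) tt)) y≰x
... | false = *<ₑ* (subst (T ∘ not) (sym eq) tt)

<ₑ⇒≤ₑ : ∀ {x y} → x <ₑ y → x ≤ₑ y
<ₑ⇒≤ₑ {x} {y} x<y = [ (λ x≤y → x≤y) , (λ y≤x → contradiction y≤x (<ₑ⇒≱ₑ x<y)) ]′ (≤ₑ-total x y)

≤-<ₑ-trans : ∀ {x y z} → x ≤ₑ y → y <ₑ z → x <ₑ z
≤-<ₑ-trans x≤y y<z = ≱ₑ⇒<ₑ (λ z≤x → <ₑ⇒≱ₑ y<z (≤ₑ-trans z≤x x≤y))

fin-<ₑ⇒< : ∀ {p q} → fin p <ₑ fin q → p < q
fin-<ₑ⇒< p<q = ℚ.≰⇒> (λ q≤p → <ₑ⇒≱ₑ p<q (≤⇒fin-≤ₑ q≤p))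

x≤ₑmaxᵉ : ∀ x y → x ≤ₑ maxᵉ x y
x≤ₑmaxᵉ x y with x ≤ᵉ y in eq
... | true  = *≤ₑ* (subst T (sym eq) tt)
... | false = ≤ₑ-refl x

y≤ₑmaxᵉ : ∀ x y → y ≤ₑ maxᵉ x y
y≤ₑmaxᵉ x y with x ≤ᵉ y in eq
... | true  = ≤ₑ-refl y
... | false = [ (λ y≤x → y≤x) , (λ x≤y → contradiction (subst T eq (drop-*≤ₑ* x≤y)) λ ()) ]′
                (≤ₑ-total y x)

maxᵉ-lub : ∀ {x y z} → x ≤ₑ z → y ≤ₑ z → maxᵉ x y ≤ₑ z
maxᵉ-lub {x} {y} x≤z y≤z with x ≤ᵉ y
... | true  = y≤z
... | false = x≤z

maxᵉ-sel : ∀ x y → maxᵉ x y ≡ x ⊎ maxᵉ x y ≡ y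
maxᵉ-sel x y with x ≤ᵉ y
... | true  = inj₂ refl
... | false = inj₁ refl

minᵉ-glb : ∀ {x y z} → z ≤ₑ x → z ≤ₑ y → z ≤ₑ minᵉ x y
minᵉ-glb {x} {y} z≤x z≤y with x ≤ᵉ y
... | true  = z≤x
... | false = z≤y

x≤ₑy⇒minᵉ≡x : ∀ {x y} → x ≤ₑ y → minᵉ x y ≡ x
x≤ₑy⇒minᵉ≡x {x} {y} (*≤ₑ* x≤y) with x ≤ᵉ y
... | true = refl

maxList-ub : ∀ {x xs} → x ∈ xs → x ≤ₑ maxList xs
maxList-ub {xs = y ∷ ys} (here refl)  = x≤ₑmaxᵉ y (maxList ys)
maxList-ub {xs = y ∷ ys} (there x∈ys) = ≤ₑ-trans (maxList-ub x∈ys) (y≤ₑmaxᵉ y (maxList ys))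

maxList-lub : ∀ {z} xs → (∀ {x} → x ∈ xs → x ≤ₑ z) → maxList xs ≤ₑ z
maxList-lub []       _  = *≤ₑ* tt
maxList-lub (x ∷ xs) ub = maxᵉ-lub (ub (here refl)) (maxList-lub xs (ub ∘ there))

maxList-mono-⊆ : ∀ {xs ys} → xs ⊆ ys → maxList xs ≤ₑ maxList ys
maxList-mono-⊆ {xs} xs⊆ys = maxList-lub xs (maxList-ub ∘ xs⊆ys)

maxList-∈ : ∀ xs → maxList xs ≡ -∞ ⊎ maxList xs ∈ xs
maxList-∈ []       = inj₁ refl
maxList-∈ (x ∷ xs) with maxᵉ-sel x (maxList xs) | maxList-∈ xs
... | inj₁ eq | _        = inj₂ (here eq)
... | inj₂ eq | inj₁ eq′ = inj₁ (≡.trans eq eq′)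
... | inj₂ eq | inj₂ ∈xs = inj₂ (there (subst (_∈ xs) (sym eq) ∈xs))

minList-glb : ∀ {z} xs → (∀ {x} → x ∈ xs → z ≤ₑ x) → z ≤ₑ minList xs
minList-glb {z} []       _  = ≤ₑ-top z
minList-glb     (x ∷ xs) lb = minᵉ-glb (lb (here refl)) (minList-glb xs (lb ∘ there))

Unique-⊆⇒length≤ : ∀ {A : Set} {xs ys : List A} → Unique xs → xs ⊆ ys → length xs ≤ℕ length ys
Unique-⊆⇒length≤ {xs = []}     _            _     = z≤n
Unique-⊆⇒length≤ {xs = x ∷ xs} (x≢xs ∷ xs!) xs⊆ys with ∈-∃++ (xs⊆ys (here refl))
... | us , ws , refl =
  ℕ.≤-trans (s≤s (Unique-⊆⇒length≤ xs! xs⊆us++ws)) (ℕ.≤-reflexive (sym (↭-length (shift x us ws))))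
  where
  xs⊆us++ws : xs ⊆ us ++ ws
  xs⊆us++ws y∈xs with ∈-resp-↭ (shift x us ws) (xs⊆ys (there y∈xs))
  ... | here refl        = contradiction refl (All.lookup x≢xs y∈xs)
  ... | there y∈us++ws = y∈us++ws

Increasing : List ℚ → Set
Increasing = AllPairs _<_

Increasing⇒Unique : ∀ {xs} → Increasing xs → Unique xs
Increasing⇒Unique = AllPairs.map ℚ.<⇒≢

insert-↭ : ∀ x xs → insert x xs ↭ x ∷ xs
insert-↭ x []       = ↭-refl
insert-↭ x (y ∷ ys) with x ≤ᵇ y
... | true  = ↭-refl
... | false = ↭-trans (prep y (insert-↭ x ys)) (swap y x ↭-refl)

sort-↭ : ∀ xs → sort xs ↭ xs
sort-↭ []       = ↭-refl
sort-↭ (x ∷ xs) = ↭-trans (insert-↭ x (sort xs)) (prep x (sort-↭ xs))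

insert-increasing : ∀ {x xs} → x ∉ xs → Increasing xs → Increasing (insert x xs)
insert-increasing {xs = []}    _  []            = [] ∷ []
insert-increasing {x} {y ∷ ys} x∉ (y<ys ∷ ys↑) with x ≤ᵇ y in eq
... | true  = (x<y ∷ All.map (ℚ.<-trans x<y) y<ys) ∷ y<ys ∷ ys↑
  where
  x<y : x < y
  x<y = ℚ.≰⇒> (λ y≤x → x∉ (here (ℚ.≤-antisym (ℚ.≤ᵇ⇒≤ (subst T (sym eq) tt)) y≤x)))
... | false = All-resp-↭ (↭-sym (insert-↭ x ys)) (y<x ∷ y<ys) ∷ insert-increasing (x∉ ∘ there) ys↑
  where
  y<x : y < x
  y<x = ℚ.≰⇒> (λ x≤y → subst T eq (ℚ.≤⇒≤ᵇ x≤y))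

sort-increasing : ∀ {xs} → Unique xs → Increasing (sort xs)
sort-increasing {[]}     []           = []
sort-increasing {x ∷ xs} (x≢xs ∷ xs!) =
  insert-increasing (λ x∈ → All.lookup x≢xs (∈-resp-↭ (sort-↭ xs) x∈) refl) (sort-increasing xs!)

deduplicateᵇ-≟ : ∀ xs → deduplicateᵇ (λ p q → does (p ≟ q)) xs ≡ deduplicate _≟_ xs
deduplicateᵇ-≟ []       = refl
deduplicateᵇ-≟ (x ∷ xs) = cong (x ∷_) (≡.trans
  (cong (filter _) (deduplicateᵇ-≟ xs))
  (filter-≐ _ _ ((λ x≉y → x≉y ∘ complete) , (λ x≢y → x≢y ∘ sound)) (deduplicate _≟_ xs)))
  where
  sound : ∀ {y} → T (does (x ≟ y)) → x ≡ y
  sound {y} with x ≟ y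
  ... | yes x≡y = λ _ → x≡y
  ... | no  _   = λ ()
  complete : ∀ {y} → x ≡ y → T (does (x ≟ y))
  complete {y} with x ≟ y
  ... | yes _   = λ _ → tt
  ... | no  x≢y = x≢y

toSet-increasing : ∀ xs → Increasing (toSet xs)
toSet-increasing xs rewrite deduplicateᵇ-≟ xs = sort-increasing (deduplicate-! _≟_ xs)

∈-toSet⁺ : ∀ {x xs} → x ∈ xs → x ∈ toSet xs
∈-toSet⁺ {xs = xs} x∈xs rewrite deduplicateᵇ-≟ xs =
  ∈-resp-↭ (↭-sym (sort-↭ _)) (∈-deduplicate⁺ _≟_ x∈xs)

∈-toSet⁻ : ∀ {x xs} → x ∈ toSet xs → x ∈ xs
∈-toSet⁻ {xs = xs} x∈ = ∈-deduplicate⁻ _ xs (∈-resp-↭ (sort-↭ _) x∈)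

2*⌊n/2⌋≤n : ∀ n → 2 * ⌊ n /2⌋ ≤ℕ n
2*⌊n/2⌋≤n zero          = z≤n
2*⌊n/2⌋≤n (suc zero)    = z≤n
2*⌊n/2⌋≤n (suc (suc n)) =
  subst (_≤ℕ suc (suc n)) (sym (ℕ.*-suc 2 ⌊ n /2⌋)) (s≤s (s≤s (2*⌊n/2⌋≤n n)))

nth-split : ∀ k xs → k <ℕ length xs →
  ∃₂ λ us vs → ∃ λ x → xs ≡ us ++ x ∷ vs × length us ≡ k × nth k xs ≡ fin x
nth-split zero    (x ∷ xs) _        = [] , xs , x , refl , refl , refl
nth-split (suc k) (y ∷ xs) (s≤s k<) with nth-split k xs k<
... | us , vs , x , refl , refl , nth≡x = y ∷ us , vs , x , refl , refl , nth≡x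

Increasing-++⁻ : ∀ us {x vs} → Increasing (us ++ x ∷ vs) → All (_< x) us × All (x <_) vs
Increasing-++⁻ []       (x<vs ∷ _)       = [] , x<vs
Increasing-++⁻ (u ∷ us) (u<rest ∷ rest↑) =
  let us<x , x<vs = Increasing-++⁻ us rest↑
  in  All.lookup u<rest (∈-++⁺ʳ us (here refl)) ∷ us<x , x<vs

record MedianSplit (xs : List ℚ) : Set where
  field
    lower upper  : List ℚ
    pivot        : ℚ
    split        : xs ≡ lower ++ pivot ∷ upper
    median≡pivot : median xs ≡ fin pivot
    lower<pivot  : All (_< pivot) lower
    pivot<upper  : All (pivot <_) upper
    lower-half   : 2 * length lower ≤ℕ length xs
    upper-half   : 2 * length upper ≤ℕ length xs

median-split : ∀ {x xs} → Increasing (x ∷ xs) → MedianSplit (x ∷ xs)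
median-split {x} {xs} xs↑ with nth-split ⌊ length xs /2⌋ (x ∷ xs) (s≤s (ℕ.⌊n/2⌋≤n (length xs)))
... | us , vs , m , split , |us|≡ , nth≡m = record
  { split        = split
  ; median≡pivot = nth≡m
  ; lower<pivot  = proj₁ (Increasing-++⁻ us (subst Increasing split xs↑))
  ; pivot<upper  = proj₂ (Increasing-++⁻ us (subst Increasing split xs↑))
  ; lower-half   = ℕ.≤-trans (ℕ.≤-reflexive (cong (2 *_) |us|≡)) (ℕ.m≤n⇒m≤1+n (2*⌊n/2⌋≤n (length xs)))
  ; upper-half   = ℕ.≤-trans (ℕ.≤-reflexive (cong (2 *_) |vs|≡)) (2*⌊n/2⌋≤n (suc (length xs)))
  }
  where
  open ≡.≡-Reasoning
  |vs|≡ : length vs ≡ ⌈ length xs /2⌉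
  |vs|≡ = ℕ.+-cancelˡ-≡ ⌊ length xs /2⌋ _ _ (begin
    ⌊ length xs /2⌋ + length vs       ≡⟨ cong (_+ length vs) (sym |us|≡) ⟩
    length us + length vs             ≡⟨ sym (length-++ us) ⟩
    length (us ++ vs)                 ≡⟨ ℕ.suc-injective (≡.trans (sym (↭-length (shift m us vs)))
                                                                   (cong length (sym split))) ⟩
    length xs                         ≡⟨ sym (ℕ.⌊n/2⌋+⌈n/2⌉≡n (length xs)) ⟩
    ⌊ length xs /2⌋ + ⌈ length xs /2⌉ ∎)

above-median-length : ∀ {A B} → Unique A → Increasing B → A ⊆ B →
  (∀ {q} → q ∈ A → median B <ₑ fin q) → 2 * length A ≤ℕ length B
above-median-length {[]}            _  _  _   _     = z≤n
above-median-length {_ ∷ _} {[]}    _  _  A⊆B _     with A⊆B (here refl)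
... | ()
above-median-length {A}     {_ ∷ _} A! B↑ A⊆B above =
  ℕ.≤-trans (ℕ.*-monoʳ-≤ 2 (Unique-⊆⇒length≤ A! A⊆upper)) upper-half
  where
  open MedianSplit (median-split B↑)
  A⊆upper : A ⊆ upper
  A⊆upper {q} q∈A = locate (∈-++⁻ lower (subst (q ∈_) split (A⊆B q∈A)))
    where
    pivot<q : pivot < q
    pivot<q = fin-<ₑ⇒< (subst (_<ₑ fin q) median≡pivot (above q∈A))
    locate : q ∈ lower ⊎ q ∈ pivot ∷ upper → q ∈ upper
    locate (inj₁ q∈lower)         = contradiction (All.lookup lower<pivot q∈lower) (ℚ.<-asym pivot<q)
    locate (inj₂ (here q≡pivot))  = contradiction (sym q≡pivot) (ℚ.<⇒≢ pivot<q)
    locate (inj₂ (there q∈upper)) = q∈upper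

below-median-length : ∀ {A B} → Unique A → Increasing B → A ⊆ B →
  (∀ {q} → q ∈ A → fin q <ₑ median B) → 2 * length A ≤ℕ length B
below-median-length {[]}            _  _  _   _     = z≤n
below-median-length {_ ∷ _} {[]}    _  _  A⊆B _     with A⊆B (here refl)
... | ()
below-median-length {A}     {_ ∷ _} A! B↑ A⊆B below =
  ℕ.≤-trans (ℕ.*-monoʳ-≤ 2 (Unique-⊆⇒length≤ A! A⊆lower)) lower-half
  where
  open MedianSplit (median-split B↑)
  A⊆lower : A ⊆ lower
  A⊆lower {q} q∈A = locate (∈-++⁻ lower (subst (q ∈_) split (A⊆B q∈A)))
    where
    q<pivot : q < pivot
    q<pivot = fin-<ₑ⇒< (subst (fin q <ₑ_) median≡pivot (below q∈A))
    locate : q ∈ lower ⊎ q ∈ pivot ∷ upper → q ∈ lower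
    locate (inj₁ q∈lower)         = q∈lower
    locate (inj₂ (here q≡pivot))  = contradiction q≡pivot (ℚ.<⇒≢ q<pivot)
    locate (inj₂ (there q∈upper)) = contradiction (All.lookup pivot<upper q∈upper) (ℚ.<-asym q<pivot)

module _ (K : ℕ) .{{_ : NonZero K}} {n : ℕ} (I : Instance n) where

  ∈-itemsIn⁻ : ∀ i {e} → e ∈ itemsIn K I i → T (inI K i (time I e))
  ∈-itemsIn⁻ _ = proj₂ ∘ ∈-filter⁻ _ {xs = items K I}

  earliest-∈ : ∀ xs {e} → earliest K I xs ≡ just e → e ∈ xs
  earliest-∈ (x ∷ xs) eq with earliest K I xs in eq′
  earliest-∈ (x ∷ xs) refl | nothing = here refl
  ... | just f with time I x ≤ᵇ time I f
  earliest-∈ (x ∷ xs) refl | just f | true  = here refl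
  earliest-∈ (x ∷ xs) refl | just f | false = there (earliest-∈ xs eq′)

  earliest-nothing : ∀ xs {e} → earliest K I xs ≡ nothing → e ∉ xs
  earliest-nothing (x ∷ xs) eq with earliest K I xs
  earliest-nothing (x ∷ xs) () | nothing
  ... | just f with time I x ≤ᵇ time I f
  earliest-nothing (x ∷ xs) () | just f | true
  earliest-nothing (x ∷ xs) () | just f | false

  pickedVal-threshold : ∀ i m →
    m ≤ₑ pickedVal K I i m ⊎ All (λ e → fin (val I e) <ₑ m) (itemsIn K I i)
  pickedVal-threshold i m with earliest K I (filterᵇ (λ e → m ≤ᵉ fin (val I e)) (itemsIn K I i)) in eq
  ... | just e  = inj₁ (*≤ₑ* (proj₂ (∈-filter⁻ _ {xs = itemsIn K I i} (earliest-∈ _ eq))))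
  ... | nothing = inj₂ (All.tabulate λ e∈ → ≱ₑ⇒<ₑ λ m≤e →
                    earliest-nothing _ eq (∈-filter⁺ _ e∈ (drop-*≤ₑ* m≤e)))

  Search-round : ∀ j → let threshold = median (Θ̂ K I (suc j)) in
    threshold ≤ₑ L̂ K I (suc (suc j)) ⊎ All (λ e → fin (val I e) <ₑ threshold) (itemsIn K I (suc j))
  Search-round j =
    Sum.map₁ (λ m≤picked → ≤ₑ-trans m≤picked (y≤ₑmaxᵉ (L̂ K I (suc j)) _))
             (pickedVal-threshold (suc j) _)

  ρ-witness : ∀ {C i} → T (high K I C i) → ∃[ e ] e ∈ itemsIn K I i × ρ K I i ≡ fin (val I e)
  ρ-witness {C} {i} high-i
    with maxList-∈ (map (λ e → fin (val I e)) (filterᵇ (not ∘ green I) (itemsIn K I i)))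
  ... | inj₁ ρ≡-∞ = ⊥-elim (subst (λ r → T (fin C ≤ᵉ r)) ρ≡-∞ high-i)
  ... | inj₂ ρ∈ with ∈-map⁻ _ ρ∈
  ... | e , e∈red , ρ≡e = e , proj₁ (∈-filter⁻ _ e∈red) , ρ≡e

  ρ≤ₑμ̂ : ∀ i → ρ K I i ≤ₑ μ̂ K I i
  ρ≤ₑμ̂ i = maxList-mono-⊆
    (Subset.map⁺ (λ e → fin (val I e)) (Subset.filter-⊆ (T? ∘ not ∘ green I) (itemsIn K I i)))

  μ̂≡ρ : ∀ {C j gmax} → T (high K I C j) → ¬ T (inI K j (time I gmax)) →
    (∀ e → T (green I e) → e ≢ gmax → val I e ≤ C) → μ̂ K I j ≡ ρ K I j
  μ̂≡ρ {C} {j} {gmax} high-j gmax∉Iⱼ C-bound = ≤ₑ-antisym (maxList-lub _ item≤ρ) (ρ≤ₑμ̂ j)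
    where
    item≤ρ : ∀ {x} → x ∈ map (λ e → fin (val I e)) (itemsIn K I j) → x ≤ₑ ρ K I j
    item≤ρ x∈ with ∈-map⁻ _ x∈
    ... | e , e∈ , refl with green I e in green-e
    ... | true  = ≤ₑ-trans (≤⇒fin-≤ₑ (C-bound e (subst T (sym green-e) tt) e≢gmax)) (*≤ₑ* high-j)
      where
      e≢gmax : e ≢ gmax
      e≢gmax refl = gmax∉Iⱼ (∈-itemsIn⁻ j e∈)
    ... | false = maxList-ub (∈-map⁺ _ (∈-filter⁺ _ e∈ (subst (T ∘ not) (sym green-e) tt)))

  nice-suc⁻ : ∀ {C gmax j} → T (nice K I C gmax (suc j)) →
    T (high K I C (suc j)) × T (high K I C j) × ¬ T (inI K j (time I gmax))
  nice-suc⁻ {C} {gmax} {j} nice-i =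
    let high-i , rest    = Equivalence.to (T-∧ {high K I C (suc j)}) nice-i
        high-j , gmax∉Iⱼ = Equivalence.to (T-∧ {high K I C j}) rest
    in  high-i , high-j , subst T (Equivalence.to T-not-≡ gmax∉Iⱼ)

  ∈-highBelow⁻ : ∀ {C i k} → k ∈ highBelow K I C i → k <ℕ i × T (high K I C k)
  ∈-highBelow⁻ {C} {suc i} k∈ with high K I C i in high-i
  ∈-highBelow⁻ {C} {suc i} (here refl) | true  = ℕ.n<1+n i , subst T (sym high-i) tt
  ∈-highBelow⁻ {C} {suc i} (there k∈)  | true  = Prod.map₁ ℕ.m<n⇒m<1+n (∈-highBelow⁻ k∈)
  ∈-highBelow⁻ {C} {suc i} k∈          | false = Prod.map₁ ℕ.m<n⇒m<1+n (∈-highBelow⁻ k∈)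

  U-suc : ∀ {C i} → T (high K I C i) → (∀ k → k <ℕ i → T (high K I C k) → ρ K I i ≤ₑ ρ K I k) →
    U K I C (suc i) ≡ ρ K I i
  U-suc {C} {i} high-i ρᵢ≤ with high K I C i
  ... | true = x≤ₑy⇒minᵉ≡x (minList-glb _ ρᵢ≤earlier)
    where
    ρᵢ≤earlier : ∀ {r} → r ∈ map (ρ K I) (highBelow K I C i) → ρ K I i ≤ₑ r
    ρᵢ≤earlier r∈ with ∈-map⁻ _ r∈
    ... | k , k∈ , refl = Prod.uncurry (ρᵢ≤ k) (∈-highBelow⁻ k∈)

  inRange : Ext → Ext → Fin n → Bool
  inRange lo hi e = (lo <ᵉ fin (val I e)) ∧ (fin (val I e) ≤ᵉ hi)

  -- The Θset lemmas avoid `with` and `refl` patterns on purpose: abstracting over goals that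
  -- mention Θset makes type checking prohibitively slow.
  ∈-Θset⁻ : ∀ {lo hi q} → q ∈ Θset K I lo hi →
    ∃[ e ] (e ∈ itemsIn K I 0 × T (inRange lo hi e)) × q ≡ val I e
  ∈-Θset⁻ {lo} {hi} q∈ =
    Prod.map₂ (Prod.map₁ (∈-filter⁻ (T? ∘ inRange lo hi) {xs = itemsIn K I 0}))
      (∈-map⁻ (val I) (∈-toSet⁻ {xs = map (val I) (filterᵇ (inRange lo hi) (itemsIn K I 0))} q∈))

  ∈-Θset⁺ : ∀ {lo hi e} → e ∈ itemsIn K I 0 → T (inRange lo hi e) → val I e ∈ Θset K I lo hi
  ∈-Θset⁺ {lo} {hi} e∈ in-range =
    ∈-toSet⁺ (∈-map⁺ (val I) (∈-filter⁺ (T? ∘ inRange lo hi) e∈ in-range))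

  inRange-bounds : ∀ {lo hi e} → T (inRange lo hi e) → lo <ₑ fin (val I e) × fin (val I e) ≤ₑ hi
  inRange-bounds in-range = Prod.map *<ₑ* *≤ₑ* (Equivalence.to T-∧ in-range)

  Θset-bounds : ∀ {lo hi q} → q ∈ Θset K I lo hi → lo <ₑ fin q × fin q ≤ₑ hi
  Θset-bounds {lo} {hi} q∈ =
    let e , (_ , in-range) , q≡e = ∈-Θset⁻ {lo} {hi} q∈
    in  subst (λ v → lo <ₑ fin v × fin v ≤ₑ hi) (sym q≡e) (inRange-bounds {lo} {hi} in-range)

  Θset-mono : ∀ {lo hi lo′ hi′} → lo ≤ₑ lo′ → hi′ ≤ₑ hi → Θset K I lo′ hi′ ⊆ Θset K I lo hi
  Θset-mono {lo} {hi} {lo′} {hi′} lo≤lo′ hi′≤hi q∈ =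
    let e , (e∈ , in-range′) , q≡e = ∈-Θset⁻ {lo′} {hi′} q∈
        lo′<e , e≤hi′ = inRange-bounds {lo′} {hi′} in-range′
        in-range = Equivalence.from T-∧
          (drop-*<ₑ* (≤-<ₑ-trans lo≤lo′ lo′<e) , drop-*≤ₑ* (≤ₑ-trans e≤hi′ hi′≤hi))
    in  subst (_∈ Θset K I lo hi) (sym q≡e) (∈-Θset⁺ {lo} {hi} e∈ in-range)

  Θset-increasing : ∀ lo hi → Increasing (Θset K I lo hi)
  Θset-increasing lo hi = toSet-increasing (map (val I) (filterᵇ (inRange lo hi) (itemsIn K I 0)))

  Θset-halving : ∀ {lo hi lo′ hi′} → lo ≤ₑ lo′ → hi′ ≤ₑ hi →
    median (Θset K I lo hi) ≤ₑ lo′ ⊎ hi′ <ₑ median (Θset K I lo hi) →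
    2 * length (Θset K I lo′ hi′) ≤ℕ length (Θset K I lo hi)
  Θset-halving {lo} {hi} {lo′} {hi′} lo≤lo′ hi′≤hi (inj₁ median≤lo′) =
    above-median-length (Increasing⇒Unique (Θset-increasing lo′ hi′)) (Θset-increasing lo hi)
      (Θset-mono lo≤lo′ hi′≤hi) λ q∈ → ≤-<ₑ-trans median≤lo′ (proj₁ (Θset-bounds {lo′} {hi′} q∈))
  Θset-halving {lo} {hi} {lo′} {hi′} lo≤lo′ hi′≤hi (inj₂ hi′<median) =
    below-median-length (Increasing⇒Unique (Θset-increasing lo′ hi′)) (Θset-increasing lo hi)
      (Θset-mono lo≤lo′ hi′≤hi) λ q∈ → ≤-<ₑ-trans (proj₂ (Θset-bounds {lo′} {hi′} q∈)) hi′<median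

lemma3p2 : (K : ℕ) .{{_ : NonZero K}} (n : ℕ) (I : Instance n) (gmax g2 : Fin n) →
    (∀ e → (+ 0 / 1 ≤ time I e) × (time I e ≤ + 1 / 1)) →
    T (green I gmax) → T (green I g2) → gmax ≢ g2 →
    (∀ e → T (green I e) → val I e ≤ val I gmax) →
    (∀ e → T (green I e) → e ≢ gmax → val I e ≤ val I g2) →
    (∀ i j → i <ℕ j → j ≤ℕ K →
      T (high K I (val I g2) i) → T (high K I (val I g2) j) →
      T (ρ K I j <ᵉ ρ K I i)) →
    (i : ℕ) → 1 ≤ℕ i → i ≤ℕ K →
    T (nice K I (val I g2) gmax i) →
    2 * length (Θ K I (val I g2) (suc i)) ≤ℕ length (Θ K I (val I g2) i)
lemma3p2 K n I gmax g2 _ _ _ _ _ C-bound ρ-decreasing (suc j) _ i≤K nice-i =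
  Θset-halving K I (x≤ₑmaxᵉ (L̂ K I i) _) Uᵢ₊₁≤Uᵢ
    (Sum.map (subst (_≤ₑ L̂ K I (suc i)) threshold≡median)
             (subst (U K I C (suc i) <ₑ_) threshold≡median ∘ Uᵢ₊₁<threshold)
             (Search-round K I j))
  where
  C = val I g2
  i = suc j
  high-i  = proj₁ (nice-suc⁻ K I {C} {gmax} {j} nice-i)
  high-j  = proj₁ (proj₂ (nice-suc⁻ K I {C} {gmax} {j} nice-i))
  gmax∉Iⱼ = proj₂ (proj₂ (nice-suc⁻ K I {C} {gmax} {j} nice-i))

  U-suc-high : ∀ {k} → k ≤ℕ K → T (high K I C k) → U K I C (suc k) ≡ ρ K I k
  U-suc-high {k} k≤K high-k =
    U-suc K I {C} {k} high-k λ l l<k high-l → <ₑ⇒≤ₑ (*<ₑ* (ρ-decreasing l k l<k k≤K high-l high-k))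

  Uᵢ₊₁≤Uᵢ : U K I C (suc i) ≤ₑ U K I C i
  Uᵢ₊₁≤Uᵢ = subst₂ _≤ₑ_ (sym (U-suc-high i≤K high-i)) (sym (U-suc-high (ℕ.<⇒≤ i≤K) high-j))
    (<ₑ⇒≤ₑ (*<ₑ* (ρ-decreasing j i (ℕ.n<1+n j) i≤K high-j high-i)))

  threshold≡median : median (Θ̂ K I i) ≡ median (Θ K I C i)
  threshold≡median = cong (median ∘ Θset K I (L̂ K I i))
    (≡.trans (μ̂≡ρ K I {C} {j} {gmax} high-j gmax∉Iⱼ C-bound) (sym (U-suc-high (ℕ.<⇒≤ i≤K) high-j)))

  Uᵢ₊₁<threshold : All (λ e → fin (val I e) <ₑ median (Θ̂ K I i)) (itemsIn K I i) →
    U K I C (suc i) <ₑ median (Θ̂ K I i)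
  Uᵢ₊₁<threshold all-below =
    let e , e∈ , ρᵢ≡e = ρ-witness K I {C} {i} high-i
    in  subst (_<ₑ median (Θ̂ K I i)) (sym (≡.trans (U-suc-high i≤K high-i) ρᵢ≡e))
          (All.lookup all-below e∈)
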